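{- Let $k\ge2$ be a constant and $K\ge1$. There is a constant $C$ such that every complete $k$-ary tree $G$ with $n$ vertices satisfies $\widetilde{\mathsf{EC}}(G)\le Cn\log n$ for every choice of rotor sequence lengths with $\tilde\kappa\le K$.
   Context: A complete $k$-ary tree is a rooted tree in which every non-leaf vertex has exactly $k$ children and all leaves are at the same depth. Unweighted deterministic walk: each vertex $u$ has a rotor sequence of length $\tilde d(u)$ of neighbours of $u$, each occurring exactly $\tilde d(u)/\deg(u)$ times, and an initial rotor position; $\tilde\kappa=\max_u\tilde d(u)/\deg(u)$. The walk moves from the current vertex to the vertex its rotor points at and then advances that rotor cyclically. $\widetilde{\mathsf{EC}}(G)$ is the maximum over start vertices and all rotor sequences/initial positions (lengths fixed) of the first time every edge has been traversed. (The paper states its bounds for specific graphs under the standing assumption $\tilde\kappa=O(1)$.) -}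

module Defs where

open import Data.Nat using (ℕ; zero; suc; _+_; _*_; _≤_; _<_; _<?_)
open import Data.Nat.Logarithm using (⌊log₂_⌋)
open import Data.Fin using (Fin)
import Data.Fin as F
open import Data.List using (List; []; _∷_; length; filter)
open import Data.List.Properties using (≡-dec)
open import Data.List.Membership.Propositional using (_∈_)
open import Data.Maybe using (Maybe; just; nothing)
open import Data.Product using (Σ; ∃; ∃-syntax; _×_; _,_)
open import Data.Sum using (_⊎_)
open import Data.Bool using (if_then_else_)
open import Relation.Nullary.Decidable using (⌊_⌋)
open import Relation.Binary.PropositionalEquality using (_≡_)
open import Relation.Binary.Definitions using (DecidableEquality)

-- A vertex is the path from the root, written as a list of child
-- indices with the LAST step first: the children of p are c ∷ p
-- (c : Fin k), the root is [].

Vertex : ℕ → Set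
Vertex k = List (Fin k)

_≟V_ : ∀ {k} → DecidableEquality (Vertex k)
_≟V_ = ≡-dec F._≟_

Valid : ∀ {k} → ℕ → Vertex k → Set
Valid h u = length u ≤ h

Child : ∀ {k} → ℕ → Vertex k → Vertex k → Set
Child {k} h p q = (∃[ c ] q ≡ c ∷ p) × length q ≤ h

Adj : ∀ {k} → ℕ → Vertex k → Vertex k → Set
Adj h u v = Child h u v ⊎ Child h v u

treeSize : ℕ → ℕ → ℕ
treeSize k zero    = 1
treeSize k (suc h) = 1 + k * treeSize k h

-- Rotor sequences.
-- seq u  : the rotor sequence of u (its length is d̃(u))
-- mult u : d̃(u)/deg(u), the number of times each neighbour occurs
-- ρ₀ u   : the initial rotor position of u

countOcc : ∀ {k} → Vertex k → List (Vertex k) → ℕ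
countOcc v xs = length (filter (v ≟V_) xs)

record ValidRotors (k h K : ℕ) (mult : Vertex k → ℕ)
                   (seq : Vertex k → List (Vertex k))
                   (ρ₀ : Vertex k → ℕ) : Set where
  field
    entries-adj : ∀ u v → Valid h u → v ∈ seq u → Adj h u v
    occurrences : ∀ u v → Valid h u → Adj h u v → countOcc v (seq u) ≡ mult u
    mult-pos    : ∀ u → Valid h u → 1 ≤ mult u
    -- κ̃ = max_u d̃(u)/deg(u) ≤ K
    mult-≤K     : ∀ u → Valid h u → mult u ≤ K
    ρ₀-bound    : ∀ u → Valid h u → 0 < length (seq u) → ρ₀ u < length (seq u)

nth : ∀ {A : Set} → List A → ℕ → Maybe A
nth []       _       = nothing
nth (x ∷ xs) zero    = just x
nth (x ∷ xs) (suc i) = nth xs i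

advance : ℕ → ℕ → ℕ
advance len r = if ⌊ suc r <? len ⌋ then suc r else 0

State : ℕ → Set
State k = Vertex k × (Vertex k → ℕ)

step : ∀ {k} → (Vertex k → List (Vertex k)) → State k → State k
step {k} seq (u , ρ) with nth (seq u) (ρ u)
... | nothing = (u , ρ)
... | just v  = (v , ρ′)
  where
  ρ′ : Vertex k → ℕ
  ρ′ w = if ⌊ w ≟V u ⌋ then advance (length (seq u)) (ρ u) else ρ w

stateAt : ∀ {k} → (Vertex k → List (Vertex k)) → State k → ℕ → State k
stateAt seq s zero    = s
stateAt seq s (suc t) = step seq (stateAt seq s t)

pos : ∀ {k} → (Vertex k → List (Vertex k)) → (Vertex k → ℕ) → Vertex k → ℕ → Vertex k
pos seq ρ₀ u₀ t = Data.Product.proj₁ (stateAt seq (u₀ , ρ₀) t)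

-- every edge of the depth-h tree is traversed (in some direction)
-- during the first T steps, i.e. the edge cover time is ≤ T
CoversEdgesBy : ∀ {k} → ℕ → (Vertex k → List (Vertex k)) → (Vertex k → ℕ)
                → Vertex k → ℕ → Set
CoversEdgesBy h seq ρ₀ u₀ T =
  ∀ u v → Valid h u → Adj h u v →
  ∃[ t ] t < T ×
    ((pos seq ρ₀ u₀ t ≡ u × pos seq ρ₀ u₀ (suc t) ≡ v)
     ⊎ (pos seq ρ₀ u₀ t ≡ v × pos seq ρ₀ u₀ (suc t) ≡ u))

module Submission where

-- Suppose the edge u → v has not been traversed during the first T steps.
-- * Rotor fairness: a rotor reads its sequence cyclically, so N departures
--   from a send ≈ N·mult(a)/d̃(a) of them to each neighbour, up to mult(a).
-- * Cut balance: removing a tree edge disconnects the tree, so the walk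
--   crosses each edge alternately in the two directions; the two traversal
--   counts differ by at most one.
-- * Propagation: call a vertex (T,B)-bounded if it was left at most B·deg(a)
--   times.  Both facts give: a (T,B)-bounded ⇒ each neighbour (T,B+2K+1)-
--   bounded.  The untraversed edge makes u (T,K)-bounded, and every z is at
--   distance ≤ 2h from u (through the root), so every z is left O(h) times.
-- * Counting: each step leaves some vertex, so T ≤ n·O(h), while n ≥ 2^h.

open import Defs
open import Data.Nat using (ℕ; _*_; _≤_)
open import Data.Nat.Logarithm using (⌊log₂_⌋)
open import Data.Product using (∃-syntax)
open import Data.List using (List)

open import Data.Nat using (zero; suc; _+_; _∸_; _<_; _^_; z≤n; s≤s; _%_; _/_; _<?_; >-nonZero)
open import Data.Nat.Properties
open import Data.Nat.DivMod using (m≡m%n+[m/n]*n; m%n<n; [m+n]%n≡m%n; [m+kn]%n≡m%n; m<n⇒m%n≡m; n%n≡0)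
open import Data.Nat.Logarithm using (⌊log₂⌋-mono-≤; ⌊log₂[2^n]⌋≡n)
open import Data.Nat.Tactic.RingSolver using (solve-∀)
open import Data.Fin as F using (Fin)
open import Data.List using ([]; _∷_; length; map; _++_; allFin)
open import Data.List.Properties using (length-map; length-++; length-tabulate; length-filter)
open import Data.List.Membership.Propositional using (_∈_)
open import Data.List.Membership.Propositional.Properties using (∈-map⁺; ∈-++⁺ˡ; ∈-++⁺ʳ; ∈-allFin)
open import Data.List.Relation.Unary.Any using (here; there)
open import Data.Maybe using (Maybe; just; nothing)
open import Data.Product using (_×_; _,_; proj₁; proj₂)
open import Data.Sum using (inj₁; inj₂)
open import Data.Bool using (Bool; true; false; _∧_; _∨_; if_then_else_)
open import Data.Empty using (⊥; ⊥-elim)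
open import Function using (_∘_)
open import Relation.Nullary using (Dec; yes; no; ¬_; does)
open import Relation.Nullary.Decidable using (⌊_⌋; _×-dec_; _⊎-dec_; dec-true; dec-false; isYes≗does)
open import Relation.Binary.PropositionalEquality

𝟙 : Bool → ℕ
𝟙 true  = 1
𝟙 false = 0

𝟙≤1 : ∀ b → 𝟙 b ≤ 1
𝟙≤1 true  = s≤s z≤n
𝟙≤1 false = z≤n

ind : ∀ {A : Set} → Dec A → ℕ
ind d = 𝟙 (does d)

ind-yes : ∀ {A : Set} (d : Dec A) → A → ind d ≡ 1
ind-yes d a = cong 𝟙 (dec-true d a)

ind-no : ∀ {A : Set} (d : Dec A) → ¬ A → ind d ≡ 0
ind-no d ¬a = cong 𝟙 (dec-false d ¬a)

⌊⌋-true : ∀ {A : Set} (d : Dec A) → A → ⌊ d ⌋ ≡ true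
⌊⌋-true d a = trans (isYes≗does d) (dec-true d a)

⌊⌋-false : ∀ {A : Set} (d : Dec A) → ¬ A → ⌊ d ⌋ ≡ false
⌊⌋-false d ¬a = trans (isYes≗does d) (dec-false d ¬a)

-- Finite sums.  sumTo n f = Σ_{j<n} f j is accumulated from the last term, so
-- a count over the first t steps of the walk grows by one term per step.

sumTo : ℕ → (ℕ → ℕ) → ℕ
sumTo zero    f = 0
sumTo (suc n) f = sumTo n f + f n

sumTo-ext< : ∀ n {f g : ℕ → ℕ} → (∀ j → j < n → f j ≡ g j) → sumTo n f ≡ sumTo n g
sumTo-ext< zero    e = refl
sumTo-ext< (suc n) e = cong₂ _+_ (sumTo-ext< n (λ j j<n → e j (m<n⇒m<1+n j<n))) (e n (n<1+n n))

sumTo-ext : ∀ n {f g : ℕ → ℕ} → (∀ j → f j ≡ g j) → sumTo n f ≡ sumTo n g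
sumTo-ext n e = sumTo-ext< n (λ j _ → e j)

sumTo-zero : ∀ n → sumTo n (λ _ → 0) ≡ 0
sumTo-zero zero    = refl
sumTo-zero (suc n) = trans (+-identityʳ _) (sumTo-zero n)

sumTo-head : ∀ n f → sumTo (suc n) f ≡ f 0 + sumTo n (f ∘ suc)
sumTo-head zero    f = sym (+-identityʳ (f 0))
sumTo-head (suc n) f = trans (cong (_+ f (suc n)) (sumTo-head n f)) (+-assoc (f 0) _ _)

sumTo-split : ∀ m n f → sumTo (m + n) f ≡ sumTo m f + sumTo n (λ j → f (m + j))
sumTo-split m zero    f rewrite +-identityʳ m = sym (+-identityʳ _)
sumTo-split m (suc n) f rewrite +-suc m n =
  trans (cong (_+ f (m + n)) (sumTo-split m n f)) (+-assoc (sumTo m f) _ _)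

sumTo-mono : ∀ {i j} f → i ≤ j → sumTo i f ≤ sumTo j f
sumTo-mono {i} {j} f i≤j = subst (λ x → sumTo i f ≤ sumTo x f) (m+[n∸m]≡n i≤j)
  (subst (sumTo i f ≤_) (sym (sumTo-split i (j ∸ i) f)) (m≤m+n _ _))

telescope : ∀ (δ δ′ φ : ℕ → ℕ) → (∀ s → δ s + φ s ≡ δ′ s + φ (suc s)) →
            ∀ t → sumTo t δ + φ 0 ≡ sumTo t δ′ + φ t
telescope δ δ′ φ balance zero    = refl
telescope δ δ′ φ balance (suc t) = +-cancelʳ-≡ (φ t) _ _ (begin
  sumTo t δ + δ t + φ 0 + φ t             ≡⟨ regroup₁ (sumTo t δ) (δ t) (φ 0) (φ t) ⟩
  (sumTo t δ + φ 0) + (δ t + φ t)         ≡⟨ cong₂ _+_ (telescope δ δ′ φ balance t) (balance t) ⟩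
  (sumTo t δ′ + φ t) + (δ′ t + φ (suc t)) ≡⟨ regroup₂ (sumTo t δ′) (φ t) (δ′ t) (φ (suc t)) ⟩
  sumTo t δ′ + δ′ t + φ (suc t) + φ t     ∎)
  where
  open ≡-Reasoning
  regroup₁ : ∀ a b c d → a + b + c + d ≡ (a + c) + (b + d)
  regroup₁ = solve-∀
  regroup₂ : ∀ a b c d → (a + b) + (c + d) ≡ a + c + d + b
  regroup₂ = solve-∀

sumOver : ∀ {A : Set} → List A → (A → ℕ) → ℕ
sumOver []       f = 0
sumOver (x ∷ xs) f = f x + sumOver xs f

sumOver-ext : ∀ {A : Set} (xs : List A) {f g : A → ℕ} → (∀ z → f z ≡ g z) → sumOver xs f ≡ sumOver xs g
sumOver-ext []       e = refl
sumOver-ext (x ∷ xs) e = cong₂ _+_ (e x) (sumOver-ext xs e)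

sumOver-+ : ∀ {A : Set} (xs : List A) (f g : A → ℕ) →
            sumOver xs (λ z → f z + g z) ≡ sumOver xs f + sumOver xs g
sumOver-+ []       f g = refl
sumOver-+ (x ∷ xs) f g rewrite sumOver-+ xs f g = interchange (f x) (g x) (sumOver xs f) (sumOver xs g)
  where
  interchange : ∀ a b c d → a + b + (c + d) ≡ a + c + (b + d)
  interchange = solve-∀

term≤sumOver : ∀ {A : Set} {xs : List A} {x} (f : A → ℕ) → x ∈ xs → f x ≤ sumOver xs f
term≤sumOver f (here refl) = m≤m+n _ _
term≤sumOver {xs = y ∷ ys} f (there x∈) = ≤-trans (term≤sumOver f x∈) (m≤n+m _ (f y))

sumOver≤ : ∀ {A : Set} (xs : List A) (f : A → ℕ) B → (∀ z → f z ≤ B) → sumOver xs f ≤ length xs * B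
sumOver≤ []       f B bound = z≤n
sumOver≤ (x ∷ xs) f B bound = +-mono-≤ (bound x) (sumOver≤ xs f B bound)

-- Cyclic reading of a list.  A rotor at position r of a sequence of length L
-- moves to r+1, wrapping to 0: after N advances it sits at (r + N) mod L.

-- x mod n, made total by x mod 0 = 0 (rotor sequences are never empty)
_mod_ : ℕ → ℕ → ℕ
x mod zero  = 0
x mod suc n = x % suc n

mod< : ∀ x {n} → 0 < n → x mod n < n
mod< x {suc n} _ = m%n<n x (suc n)

mod-small : ∀ {m n} → m < n → m mod n ≡ m
mod-small {m} {suc n} m<n = m<n⇒m%n≡m m<n

advance-below : ∀ n r → suc r < n → advance n r ≡ suc r
advance-below n r lt = cong (λ b → if b then suc r else 0) (⌊⌋-true (suc r <? n) lt)

advance-wrap : ∀ n r → ¬ (suc r < n) → advance n r ≡ 0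
advance-wrap n r nlt = cong (λ b → if b then suc r else 0) (⌊⌋-false (suc r <? n) nlt)

advance-mod : ∀ m n → 0 < n → advance n (m mod n) ≡ suc m mod n
advance-mod m (suc l) _ with suc (m % suc l) ≟ suc l
... | no ne = trans (advance-below (suc l) (m % suc l) lt) (sym (begin
      suc m % suc l                           ≡⟨ cong (λ z → suc z % suc l) (m≡m%n+[m/n]*n m (suc l)) ⟩
      (suc (m % suc l) + m / suc l * suc l) % suc l ≡⟨ [m+kn]%n≡m%n (suc (m % suc l)) (m / suc l) (suc l) ⟩
      suc (m % suc l) % suc l                 ≡⟨ m<n⇒m%n≡m lt ⟩
      suc (m % suc l)                         ∎))
  where
  open ≡-Reasoning
  lt : suc (m % suc l) < suc l
  lt = ≤∧≢⇒< (m%n<n m (suc l)) ne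
... | yes wraps = trans (advance-wrap (suc l) (m % suc l) (<-irrefl wraps)) (sym (begin
      suc m % suc l                           ≡⟨ cong (λ z → suc z % suc l) (m≡m%n+[m/n]*n m (suc l)) ⟩
      (suc (m % suc l) + m / suc l * suc l) % suc l ≡⟨ [m+kn]%n≡m%n (suc (m % suc l)) (m / suc l) (suc l) ⟩
      suc (m % suc l) % suc l                 ≡⟨ cong (_% suc l) wraps ⟩
      suc l % suc l                           ≡⟨ n%n≡0 (suc l) ⟩
      0                                       ∎))
  where open ≡-Reasoning

isEntry : ∀ {k} → Maybe (Vertex k) → Vertex k → ℕ
isEntry nothing  b = 0
isEntry (just v) b = ind (v ≟V b)

hit : ∀ {k} → List (Vertex k) → ℕ → Vertex k → ℕ
hit xs p b = isEntry (nth xs p) b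

ind-≟V-sym : ∀ {k} (x y : Vertex k) → ind (x ≟V y) ≡ ind (y ≟V x)
ind-≟V-sym x y with x ≟V y
... | yes x≡y = sym (ind-yes (y ≟V x) (sym x≡y))
... | no  x≢y = sym (ind-no (y ≟V x) (x≢y ∘ sym))

countOcc-∷ : ∀ {k} (v x : Vertex k) xs → countOcc v (x ∷ xs) ≡ ind (v ≟V x) + countOcc v xs
countOcc-∷ v x xs with v ≟V x
... | yes _ = refl
... | no  _ = refl

hits-total : ∀ {k} (b : Vertex k) xs → sumTo (length xs) (λ p → hit xs p b) ≡ countOcc b xs
hits-total b []       = refl
hits-total b (x ∷ xs) = begin
  sumTo (suc (length xs)) (λ p → hit (x ∷ xs) p b) ≡⟨ sumTo-head (length xs) _ ⟩
  ind (x ≟V b) + sumTo (length xs) (λ p → hit xs p b) ≡⟨ cong₂ _+_ (ind-≟V-sym x b) (hits-total b xs) ⟩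
  ind (b ≟V x) + countOcc b xs                     ≡⟨ countOcc-∷ b x xs ⟨
  countOcc b (x ∷ xs)                              ∎
  where open ≡-Reasoning

cyclicHits : ∀ {k} → List (Vertex k) → ℕ → Vertex k → ℕ → ℕ
cyclicHits xs r b i = sumTo i (λ j → hit xs ((r + j) mod length xs) b)

-- For a list of length L = suc l with c copies of b, every window of L
-- consecutive cyclic reads contains exactly c copies of b; hence i reads
-- contain between ⌊i/L⌋·c and (⌊i/L⌋+1)·c of them.
private
  module Periodic {k} (xs : List (Vertex k)) (l : ℕ) (length≡ : length xs ≡ suc l)
                  (r : ℕ) (r<L : r < suc l) (b : Vertex k) where
    L = suc l
    c = countOcc b xs

    g : ℕ → ℕ
    g j = hit xs ((r + j) % L) b

    g-periodic : ∀ s → g (s + L) ≡ g s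
    g-periodic s = cong (λ p → hit xs p b)
      (trans (cong (_% L) (sym (+-assoc r s L))) ([m+n]%n≡m%n (r + s) L))

    window : ℕ → ℕ
    window s = sumTo L (λ j → g (s + j))

    window-shift : ∀ s → window (suc s) ≡ window s
    window-shift s = +-cancelˡ-≡ (g s) _ _ (begin
      g s + window (suc s)                 ≡⟨ cong (g s +_) (sumTo-ext L (λ j → cong g (+-suc s j))) ⟨
      g s + sumTo L (λ j → g (s + suc j))  ≡⟨ cong (λ z → g z + sumTo L (λ j → g (s + suc j))) (+-identityʳ s) ⟨
      g (s + 0) + sumTo L (λ j → g (s + suc j)) ≡⟨ sumTo-head L (λ j → g (s + j)) ⟨
      sumTo (suc L) (λ j → g (s + j))      ≡⟨⟩
      window s + g (s + L)                 ≡⟨ cong (window s +_) (g-periodic s) ⟩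
      window s + g s                       ≡⟨ +-comm (window s) (g s) ⟩
      g s + window s                       ∎)
      where open ≡-Reasoning

    -- the window starting where the reads reach position 0 reads xs in order
    window-aligned : window (L ∸ r) ≡ c
    window-aligned = trans (sumTo-ext< L (λ j j<L → cong (λ p → hit xs p b) (position j j<L)))
                           (subst (λ n → sumTo n (λ j → hit xs j b) ≡ c) length≡ (hits-total b xs))
      where
      position : ∀ j → j < L → (r + (L ∸ r + j)) % L ≡ j
      position j j<L = begin
        (r + (L ∸ r + j)) % L ≡⟨ cong (_% L) (sym (+-assoc r (L ∸ r) j)) ⟩
        (r + (L ∸ r) + j) % L ≡⟨ cong (λ z → (z + j) % L) (m+[n∸m]≡n (<⇒≤ r<L)) ⟩
        (L + j) % L           ≡⟨ cong (_% L) (+-comm L j) ⟩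
        (j + L) % L           ≡⟨ [m+n]%n≡m%n j L ⟩
        j % L                 ≡⟨ m<n⇒m%n≡m j<L ⟩
        j                     ∎
        where open ≡-Reasoning

    window≡c : ∀ s → window s ≡ c
    window≡c s = trans (window-const s) (trans (sym (window-const (L ∸ r))) window-aligned)
      where
      window-const : ∀ s → window s ≡ window 0
      window-const zero    = refl
      window-const (suc s) = trans (window-shift s) (window-const s)

    reads : ℕ → ℕ
    reads i = sumTo i g

    reads-periods : ∀ q → reads (q * L) ≡ q * c
    reads-periods zero    = refl
    reads-periods (suc q) = begin
      reads (L + q * L)        ≡⟨ cong reads (+-comm L (q * L)) ⟩
      reads (q * L + L)        ≡⟨ sumTo-split (q * L) L g ⟩
      reads (q * L) + window (q * L) ≡⟨ cong₂ _+_ (reads-periods q) (window≡c (q * L)) ⟩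
      q * c + c                ≡⟨ +-comm (q * c) c ⟩
      suc q * c                ∎
      where open ≡-Reasoning

    reads≡cyclicHits : ∀ i → reads i ≡ cyclicHits xs r b i
    reads≡cyclicHits i = sumTo-ext i (λ j → cong (λ n → hit xs ((r + j) mod n) b) (sym length≡))

    module _ (i : ℕ) where
      q = i / L
      i≡ : i ≡ i % L + q * L
      i≡ = m≡m%n+[m/n]*n i L

      reads-lower : q * c ≤ reads i
      reads-lower = subst (_≤ reads i) (reads-periods q)
        (sumTo-mono g (subst (q * L ≤_) (sym i≡) (m≤n+m (q * L) (i % L))))

      reads-upper : reads i ≤ suc q * c
      reads-upper = subst (reads i ≤_) (reads-periods (suc q))
        (sumTo-mono g (subst (_≤ suc q * L) (sym i≡) (+-monoˡ-≤ (q * L) (<⇒≤ (m%n<n i L)))))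

      fair-lower : c * i ≤ L * reads i + c * L
      fair-lower = begin
        c * i                ≡⟨ cong (c *_) i≡ ⟩
        c * (i % L + q * L)  ≡⟨ expand c (i % L) q L ⟩
        L * (q * c) + c * (i % L) ≤⟨ +-mono-≤ (*-monoʳ-≤ L reads-lower) (*-monoʳ-≤ c (<⇒≤ (m%n<n i L))) ⟩
        L * reads i + c * L  ∎
        where
        open ≤-Reasoning
        expand : ∀ c ρ q L → c * (ρ + q * L) ≡ L * (q * c) + c * ρ
        expand = solve-∀

      fair-upper : L * reads i ≤ c * i + c * L
      fair-upper = begin
        L * reads i          ≤⟨ *-monoʳ-≤ L reads-upper ⟩
        L * (suc q * c)      ≡⟨ expand L q c ⟩
        c * (q * L) + c * L  ≤⟨ +-monoˡ-≤ (c * L) (*-monoʳ-≤ c (subst (q * L ≤_) (sym i≡) (m≤n+m (q * L) (i % L)))) ⟩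
        c * i + c * L        ∎
        where
        open ≤-Reasoning
        expand : ∀ L q c → L * (suc q * c) ≡ c * (q * L) + c * L
        expand = solve-∀

      fair : c * i ≤ length xs * cyclicHits xs r b i + c * length xs ×
             length xs * cyclicHits xs r b i ≤ c * i + c * length xs
      fair = subst₂ (λ n H → c * i ≤ n * H + c * n × n * H ≤ c * i + c * n)
                    (sym length≡) (reads≡cyclicHits i) (fair-lower , fair-upper)

cyclic-fair : ∀ {k} (xs : List (Vertex k)) r b → r < length xs → ∀ i →
  countOcc b xs * i ≤ length xs * cyclicHits xs r b i + countOcc b xs * length xs ×
  length xs * cyclicHits xs r b i ≤ countOcc b xs * i + countOcc b xs * length xs
cyclic-fair xs r b r<L i = Periodic.fair xs l length≡ r (subst (r <_) length≡ r<L) b i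
  where
  l = length xs ∸ 1
  length≡ : length xs ≡ suc l
  length≡ = sym (m+[n∸m]≡n (≤-trans (s≤s z≤n) r<L))

module _ {k : ℕ} where

  depth-≢ : ∀ {p q : Vertex k} → length q < length p → p ≢ q
  depth-≢ lt p≡q = <-irrefl (sym (cong length p≡q)) lt

  Adj-valid : ∀ {h} {a b : Vertex k} → Valid h a → Adj h a b → Valid h b
  Adj-valid va (inj₁ (_ , valid-b)) = valid-b
  Adj-valid va (inj₂ ((c , refl) , _)) = ≤-trans (n≤1+n _) va

  Adj-sym : ∀ {h} {a b : Vertex k} → Adj h a b → Adj h b a
  Adj-sym (inj₁ child) = inj₂ child
  Adj-sym (inj₂ child) = inj₁ child

  no-edge-at-depth-0 : ∀ {u v : Vertex k} → Valid 0 u → Adj 0 u v → ⊥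
  no-edge-at-depth-0 {[]}    _  (inj₁ ((_ , refl) , ()))
  no-edge-at-depth-0 {[]}    _  (inj₂ ((_ , ()) , _))
  no-edge-at-depth-0 {_ ∷ _} () _

  hasNeighbour : ∀ {h} → 1 ≤ k → 1 ≤ h → ∀ a → Valid h a → ∃[ b ] Adj h a b
  hasNeighbour k≥1 h≥1 []      _  = (F.fromℕ< k≥1 ∷ []) , inj₁ ((F.fromℕ< k≥1 , refl) , h≥1)
  hasNeighbour _   _   (c ∷ p) va = p , inj₂ ((c , refl) , va)

  children : Vertex k → List (Vertex k)
  children z = map (_∷ z) (allFin k)

  length-children : ∀ z → length (children z) ≡ k
  length-children z = trans (length-map (_∷ z) (allFin k)) (length-tabulate (λ i → i))

  neighbourhood : Vertex k → List (Vertex k)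
  neighbourhood []      = children []
  neighbourhood (c ∷ p) = p ∷ children (c ∷ p)

  length-neighbourhood : ∀ z → length (neighbourhood z) ≤ suc k
  length-neighbourhood []      = ≤-trans (≤-reflexive (length-children [])) (n≤1+n k)
  length-neighbourhood (c ∷ p) = s≤s (≤-reflexive (length-children (c ∷ p)))

  Adj⇒∈neighbourhood : ∀ {h} (z v : Vertex k) → Adj h z v → v ∈ neighbourhood z
  Adj⇒∈neighbourhood []      v (inj₁ ((c , refl) , _)) = ∈-map⁺ (_∷ []) (∈-allFin c)
  Adj⇒∈neighbourhood (d ∷ p) v (inj₁ ((c , refl) , _)) = there (∈-map⁺ (_∷ (d ∷ p)) (∈-allFin c))
  Adj⇒∈neighbourhood z       v (inj₂ ((c , refl) , _)) = here refl

  childrenOf : List (Vertex k) → List (Vertex k)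
  childrenOf []       = []
  childrenOf (q ∷ qs) = children q ++ childrenOf qs

  allVertices : ℕ → List (Vertex k)
  allVertices zero    = [] ∷ []
  allVertices (suc h) = [] ∷ childrenOf (allVertices h)

  length-childrenOf : ∀ qs → length (childrenOf qs) ≡ k * length qs
  length-childrenOf []       = sym (*-zeroʳ k)
  length-childrenOf (q ∷ qs) = begin
    length (children q ++ childrenOf qs)        ≡⟨ length-++ (children q) ⟩
    length (children q) + length (childrenOf qs) ≡⟨ cong₂ _+_ (length-children q) (length-childrenOf qs) ⟩
    k + k * length qs                           ≡⟨ *-suc k (length qs) ⟨
    k * suc (length qs)                         ∎
    where open ≡-Reasoning

  length-allVertices : ∀ h → length (allVertices h) ≡ treeSize k h
  length-allVertices zero    = refl
  length-allVertices (suc h) =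
    cong suc (trans (length-childrenOf (allVertices h)) (cong (k *_) (length-allVertices h)))

  ∈-childrenOf : ∀ (c : Fin k) {q} qs → q ∈ qs → (c ∷ q) ∈ childrenOf qs
  ∈-childrenOf c (q ∷ qs) (here refl) = ∈-++⁺ˡ (∈-map⁺ (_∷ q) (∈-allFin c))
  ∈-childrenOf c (q ∷ qs) (there q∈)  = ∈-++⁺ʳ (children q) (∈-childrenOf c qs q∈)

  ∈-allVertices : ∀ h (x : Vertex k) → Valid h x → x ∈ allVertices h
  ∈-allVertices zero    []      _         = here refl
  ∈-allVertices (suc h) []      _         = here refl
  ∈-allVertices (suc h) (c ∷ x) (s≤s vx) = there (∈-childrenOf c (allVertices h) (∈-allVertices h x vx))

  inSubtree : Vertex k → Vertex k → Bool
  inSubtree y []      = does ([] ≟V y)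
  inSubtree y (d ∷ q) = does ((d ∷ q) ≟V y) ∨ inSubtree y q

  inSubtree-∷ : ∀ y d q → (d ∷ q) ≢ y → inSubtree y (d ∷ q) ≡ inSubtree y q
  inSubtree-∷ y d q ne = cong (_∨ inSubtree y q) (dec-false ((d ∷ q) ≟V y) ne)

  inSubtree-shallow : ∀ y q → length q < length y → inSubtree y q ≡ false
  inSubtree-shallow y []      lt = dec-false ([] ≟V y) (λ e → depth-≢ lt (sym e))
  inSubtree-shallow y (d ∷ q) lt =
    trans (inSubtree-∷ y d q (λ e → depth-≢ lt (sym e))) (inSubtree-shallow y q (<-trans (n<1+n _) lt))

  inSubtree-root : ∀ (d : Fin k) q → inSubtree (d ∷ q) (d ∷ q) ≡ true
  inSubtree-root d q = cong (_∨ inSubtree (d ∷ q) q) (dec-true ((d ∷ q) ≟V (d ∷ q)) refl)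

  -- Cut balance for one step along the edge x — c ∷ x: crossing it downwards
  -- enters the subtree of c ∷ x, crossing it upwards leaves it, and any other
  -- step stays on its side.
  Crosses : Vertex k → Vertex k → Vertex k → Vertex k → Set
  Crosses a b x y = a ≡ x × b ≡ y

  crosses? : ∀ a b x y → Dec (Crosses a b x y)
  crosses? a b x y = (a ≟V x) ×-dec (b ≟V y)

  ind-crosses-from : ∀ x b y → ind (crosses? x b x y) ≡ ind (b ≟V y)
  ind-crosses-from x b y = cong (λ z → 𝟙 (z ∧ does (b ≟V y))) (dec-true (x ≟V x) refl)

  cut-down : ∀ c x a d →
    ind (crosses? a (d ∷ a) x (c ∷ x)) + 𝟙 (inSubtree (c ∷ x) a)
      ≡ ind (crosses? a (d ∷ a) (c ∷ x) x) + 𝟙 (inSubtree (c ∷ x) (d ∷ a))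
  cut-down c x a d with (d ∷ a) ≟V (c ∷ x)
  ... | yes refl = begin
    ind (crosses? x (c ∷ x) x (c ∷ x)) + 𝟙 (inSubtree (c ∷ x) x)
      ≡⟨ cong₂ _+_ (ind-yes (crosses? x (c ∷ x) x (c ∷ x)) (refl , refl))
                   (cong 𝟙 (inSubtree-shallow (c ∷ x) x (n<1+n _))) ⟩
    1 + 0
      ≡⟨ cong₂ _+_ (ind-no (crosses? x (c ∷ x) (c ∷ x) x) (λ (e , _) → depth-≢ (n<1+n _) (sym e)))
                   (cong 𝟙 (inSubtree-root c x)) ⟨
    ind (crosses? x (c ∷ x) (c ∷ x) x) + 𝟙 (inSubtree (c ∷ x) (c ∷ x)) ∎
    where open ≡-Reasoning
  ... | no ne = cong₂ _+_
    (trans (ind-no (crosses? a (d ∷ a) x (c ∷ x)) (ne ∘ proj₂))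
           (sym (ind-no (crosses? a (d ∷ a) (c ∷ x) x) upwards)))
    (cong 𝟙 (sym (inSubtree-∷ (c ∷ x) d a ne)))
    where
    upwards : ¬ Crosses a (d ∷ a) (c ∷ x) x
    upwards (refl , e) = depth-≢ {d ∷ c ∷ x} {x} (<-trans (n<1+n _) (n<1+n _)) e

  cut-up : ∀ c x b d →
    ind (crosses? (d ∷ b) b x (c ∷ x)) + 𝟙 (inSubtree (c ∷ x) (d ∷ b))
      ≡ ind (crosses? (d ∷ b) b (c ∷ x) x) + 𝟙 (inSubtree (c ∷ x) b)
  cut-up c x b d with (d ∷ b) ≟V (c ∷ x)
  ... | yes refl = begin
    ind (crosses? (c ∷ x) x x (c ∷ x)) + 𝟙 (inSubtree (c ∷ x) (c ∷ x))
      ≡⟨ cong₂ _+_ (ind-no (crosses? (c ∷ x) x x (c ∷ x)) (λ (e , _) → depth-≢ (n<1+n _) e))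
                   (cong 𝟙 (inSubtree-root c x)) ⟩
    0 + 1
      ≡⟨ cong₂ _+_ (ind-yes (crosses? (c ∷ x) x (c ∷ x) x) (refl , refl))
                   (cong 𝟙 (inSubtree-shallow (c ∷ x) x (n<1+n _))) ⟨
    ind (crosses? (c ∷ x) x (c ∷ x) x) + 𝟙 (inSubtree (c ∷ x) x) ∎
    where open ≡-Reasoning
  ... | no ne = cong₂ _+_
    (trans (ind-no (crosses? (d ∷ b) b x (c ∷ x)) downwards)
           (sym (ind-no (crosses? (d ∷ b) b (c ∷ x) x) (ne ∘ proj₁))))
    (cong 𝟙 (inSubtree-∷ (c ∷ x) d b ne))
    where
    downwards : ¬ Crosses (d ∷ b) b x (c ∷ x)
    downwards (e , refl) = depth-≢ {d ∷ c ∷ x} {x} (<-trans (n<1+n _) (n<1+n _)) e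

  cut-step : ∀ {h} c x {a b} → Adj h a b →
    ind (crosses? a b x (c ∷ x)) + 𝟙 (inSubtree (c ∷ x) a)
      ≡ ind (crosses? a b (c ∷ x) x) + 𝟙 (inSubtree (c ∷ x) b)
  cut-step c x (inj₁ ((d , refl) , _)) = cut-down c x _ d
  cut-step c x (inj₂ ((d , refl) , _)) = cut-up c x _ d

module _ {k : ℕ} where

  countOcc-pos : ∀ (v : Vertex k) xs → 1 ≤ countOcc v xs → v ∈ xs
  countOcc-pos v (x ∷ xs) pos with v ≟V x
  ... | yes v≡x = here v≡x
  ... | no  _   = there (countOcc-pos v xs pos)

  length≤sumCounts : ∀ (xs cs : List (Vertex k)) → (∀ x → x ∈ xs → x ∈ cs) →
                     length xs ≤ sumOver cs (λ v → countOcc v xs)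
  length≤sumCounts []       cs ⊆cs = z≤n
  length≤sumCounts (x ∷ xs) cs ⊆cs = begin
    1 + length xs
      ≤⟨ +-mono-≤ x-counted (length≤sumCounts xs cs (λ z z∈ → ⊆cs z (there z∈))) ⟩
    sumOver cs (λ v → ind (v ≟V x)) + sumOver cs (λ v → countOcc v xs)
      ≡⟨ sumOver-+ cs _ _ ⟨
    sumOver cs (λ v → ind (v ≟V x) + countOcc v xs)
      ≡⟨ sumOver-ext cs (λ v → countOcc-∷ v x xs) ⟨
    sumOver cs (λ v → countOcc v (x ∷ xs)) ∎
    where
    open ≤-Reasoning
    x-counted : 1 ≤ sumOver cs (λ v → ind (v ≟V x))
    x-counted = subst (_≤ sumOver cs (λ v → ind (v ≟V x))) (ind-yes (x ≟V x) refl)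
                      (term≤sumOver (λ v → ind (v ≟V x)) (⊆cs x (here refl)))

module _ {k h K : ℕ} {mult : Vertex k → ℕ} {seq : Vertex k → List (Vertex k)} {ρ₀ : Vertex k → ℕ}
         (rotors : ValidRotors k h K mult seq ρ₀) where
  open ValidRotors rotors

  rotor-nonempty : 1 ≤ k → 1 ≤ h → ∀ a → Valid h a → 0 < length (seq a)
  rotor-nonempty k≥1 h≥1 a va with hasNeighbour k≥1 h≥1 a va
  ... | b , adj = begin
    1                   ≤⟨ mult-pos a va ⟩
    mult a              ≡⟨ occurrences a b va adj ⟨
    countOcc b (seq a)  ≤⟨ length-filter (b ≟V_) (seq a) ⟩
    length (seq a)      ∎
    where open ≤-Reasoning

  -- a rotor sequence lists at most k+1 neighbours, each at most K times
  rotor-length≤ : ∀ a → Valid h a → length (seq a) ≤ suc k * K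
  rotor-length≤ a va = begin
    length (seq a)                                    ≤⟨ length≤sumCounts (seq a) (neighbourhood a) entries-near ⟩
    sumOver (neighbourhood a) (λ v → countOcc v (seq a)) ≤⟨ sumOver≤ (neighbourhood a) _ K count≤K ⟩
    length (neighbourhood a) * K                      ≤⟨ *-monoˡ-≤ K (length-neighbourhood a) ⟩
    suc k * K                                         ∎
    where
    open ≤-Reasoning
    entries-near : ∀ v → v ∈ seq a → v ∈ neighbourhood a
    entries-near v v∈ = Adj⇒∈neighbourhood a v (entries-adj a v va v∈)
    count≤K : ∀ v → countOcc v (seq a) ≤ K
    count≤K v with 1 ≤? countOcc v (seq a)
    ... | yes occurs = ≤-trans (≤-reflexive (occurrences a v va (entries-adj a v va (countOcc-pos v (seq a) occurs))))
                               (mult-≤K a va)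
    ... | no  absent = ≤-trans (≤-pred (≰⇒> absent)) z≤n

nth-just : ∀ {A : Set} (xs : List A) i → i < length xs → ∃[ v ] (nth xs i ≡ just v × v ∈ xs)
nth-just (x ∷ xs) zero    _        = x , refl , here refl
nth-just (x ∷ xs) (suc i) (s≤s lt) with nth-just xs i lt
... | v , nth≡ , v∈ = v , nth≡ , there v∈

step-just : ∀ {k} (seq : Vertex k → List (Vertex k)) u ρ v → nth (seq u) (ρ u) ≡ just v →
  step seq (u , ρ) ≡ (v , λ w → if ⌊ w ≟V u ⌋ then advance (length (seq u)) (ρ u) else ρ w)
step-just seq u ρ v nth≡ with nth (seq u) (ρ u) | nth≡
... | just _ | refl = refl

-- the constant of the propagation step: B grows by 2K+1 per edge
slack : ℕ → ℕ
slack K = K + (1 + K)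

module Walk {k h K : ℕ} {mult : Vertex k → ℕ} {seq : Vertex k → List (Vertex k)}
            {ρ₀ : Vertex k → ℕ} (rotors : ValidRotors k h K mult seq ρ₀)
            (nonempty : ∀ a → Valid h a → 0 < length (seq a))
            (u₀ : Vertex k) (valid-u₀ : Valid h u₀) where
  open ValidRotors rotors

  L : Vertex k → ℕ
  L a = length (seq a)

  P : ℕ → Vertex k
  P = pos seq ρ₀ u₀

  R : ℕ → Vertex k → ℕ
  R t = proj₂ (stateAt seq (u₀ , ρ₀) t)

  visits : ℕ → Vertex k → ℕ
  visits t a = sumTo t (λ s → ind (P s ≟V a))

  traversals : ℕ → Vertex k → Vertex k → ℕ
  traversals t a b = sumTo t (λ s → ind (crosses? (P s) (P (suc s)) a b))

  visits-here : ∀ t a → P t ≡ a → visits (suc t) a ≡ visits t a + 1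
  visits-here t a e = cong (visits t a +_) (ind-yes (P t ≟V a) e)

  visits-elsewhere : ∀ t a → P t ≢ a → visits (suc t) a ≡ visits t a
  visits-elsewhere t a ne = trans (cong (visits t a +_) (ind-no (P t ≟V a) ne)) (+-identityʳ _)

  RotorInv : ℕ → Set
  RotorInv t = ∀ a → Valid h a → R t a ≡ (ρ₀ a + visits t a) mod L a

  module OneStep (t : ℕ) (valid-t : Valid h (P t)) (inv-t : RotorInv t) where
    u = P t

    entry : ∃[ v ] (nth (seq u) (R t u) ≡ just v × v ∈ seq u)
    entry = nth-just (seq u) (R t u) (subst (_< L u) (sym (inv-t u valid-t)) (mod< _ (nonempty u valid-t)))

    v = proj₁ entry

    step≡ : stateAt seq (u₀ , ρ₀) (suc t) ≡ (v , λ w → if ⌊ w ≟V u ⌋ then advance (L u) (R t u) else R t w)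
    step≡ = step-just seq u (R t) v (proj₁ (proj₂ entry))

    adj-next : Adj h u (P (suc t))
    adj-next = subst (Adj h u) (sym (cong proj₁ step≡)) (entries-adj u v valid-t (proj₂ (proj₂ entry)))

    hit-next : ∀ b → hit (seq u) ((ρ₀ u + visits t u) mod L u) b ≡ ind (P (suc t) ≟V b)
    hit-next b = begin
      hit (seq u) ((ρ₀ u + visits t u) mod L u) b ≡⟨ cong (λ p → hit (seq u) p b) (inv-t u valid-t) ⟨
      isEntry (nth (seq u) (R t u)) b             ≡⟨ cong (λ m → isEntry m b) (proj₁ (proj₂ entry)) ⟩
      ind (v ≟V b)                                ≡⟨ cong (λ w → ind (w ≟V b)) (cong proj₁ step≡) ⟨
      ind (P (suc t) ≟V b)                        ∎
      where open ≡-Reasoning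

    inv-next : RotorInv (suc t)
    inv-next a va with a ≟V u
    ... | yes refl = begin
      R (suc t) u
        ≡⟨ cong (λ s → proj₂ s u) step≡ ⟩
      (if ⌊ u ≟V u ⌋ then advance (L u) (R t u) else R t u)
        ≡⟨ cong (λ b → if b then advance (L u) (R t u) else R t u) (⌊⌋-true (u ≟V u) refl) ⟩
      advance (L u) (R t u)
        ≡⟨ cong (advance (L u)) (inv-t u valid-t) ⟩
      advance (L u) ((ρ₀ u + visits t u) mod L u)
        ≡⟨ advance-mod _ _ (nonempty u valid-t) ⟩
      suc (ρ₀ u + visits t u) mod L u
        ≡⟨ cong (_mod L u) (trans (sym (+-suc (ρ₀ u) (visits t u))) (cong (ρ₀ u +_) (+-comm 1 (visits t u)))) ⟩
      (ρ₀ u + (visits t u + 1)) mod L u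
        ≡⟨ cong (λ n → (ρ₀ u + n) mod L u) (visits-here t u refl) ⟨
      (ρ₀ u + visits (suc t) u) mod L u ∎
      where open ≡-Reasoning
    ... | no a≢u = begin
      R (suc t) a
        ≡⟨ cong (λ s → proj₂ s a) step≡ ⟩
      (if ⌊ a ≟V u ⌋ then advance (L u) (R t u) else R t a)
        ≡⟨ cong (λ b → if b then advance (L u) (R t u) else R t a) (⌊⌋-false (a ≟V u) a≢u) ⟩
      R t a
        ≡⟨ inv-t a va ⟩
      (ρ₀ a + visits t a) mod L a
        ≡⟨ cong (λ n → (ρ₀ a + n) mod L a) (visits-elsewhere t a (a≢u ∘ sym)) ⟨
      (ρ₀ a + visits (suc t) a) mod L a ∎
      where open ≡-Reasoning

  invariant : ∀ t → Valid h (P t) × RotorInv t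
  invariant zero    = valid-u₀ , λ a va →
    sym (trans (cong (_mod L a) (+-identityʳ (ρ₀ a))) (mod-small (ρ₀-bound a va (nonempty a va))))
  invariant (suc t) with invariant t
  ... | valid-t , inv-t = Adj-valid valid-t (OneStep.adj-next t valid-t inv-t) , OneStep.inv-next t valid-t inv-t

  valid-pos : ∀ t → Valid h (P t)
  valid-pos t = proj₁ (invariant t)

  adj-step : ∀ t → Adj h (P t) (P (suc t))
  adj-step t = OneStep.adj-next t (valid-pos t) (proj₂ (invariant t))

  traversals-cyclic : ∀ t a b → traversals t a b ≡ cyclicHits (seq a) (ρ₀ a) b (visits t a)
  traversals-cyclic zero    a b = refl
  traversals-cyclic (suc t) a b with a ≟V P t
  ... | no a≢P = begin
    traversals t a b + ind (crosses? (P t) (P (suc t)) a b)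
      ≡⟨ cong (traversals t a b +_) (ind-no (crosses? (P t) (P (suc t)) a b) (a≢P ∘ sym ∘ proj₁)) ⟩
    traversals t a b + 0                         ≡⟨ +-identityʳ _ ⟩
    traversals t a b                             ≡⟨ traversals-cyclic t a b ⟩
    cyclicHits (seq a) (ρ₀ a) b (visits t a)     ≡⟨ cong (cyclicHits (seq a) (ρ₀ a) b) (visits-elsewhere t a (a≢P ∘ sym)) ⟨
    cyclicHits (seq a) (ρ₀ a) b (visits (suc t) a) ∎
    where open ≡-Reasoning
  ... | yes refl = begin
    traversals t u b + ind (crosses? u (P (suc t)) u b)
      ≡⟨ cong₂ _+_ (traversals-cyclic t u b) (ind-crosses-from u (P (suc t)) b) ⟩
    cyclicHits (seq u) (ρ₀ u) b N + ind (P (suc t) ≟V b)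
      ≡⟨ cong (cyclicHits (seq u) (ρ₀ u) b N +_) (OneStep.hit-next t (valid-pos t) (proj₂ (invariant t)) b) ⟨
    cyclicHits (seq u) (ρ₀ u) b (suc N)
      ≡⟨ cong (cyclicHits (seq u) (ρ₀ u) b) (trans (+-comm 1 N) (sym (visits-here t u refl))) ⟩
    cyclicHits (seq u) (ρ₀ u) b (visits (suc t) u) ∎
    where
    open ≡-Reasoning
    u = P t
    N = visits t u

  fair : ∀ t a b → Valid h a → Adj h a b →
    mult a * visits t a ≤ L a * traversals t a b + mult a * L a ×
    L a * traversals t a b ≤ mult a * visits t a + mult a * L a
  fair t a b va adj =
    subst₂ (λ m H → m * visits t a ≤ L a * H + m * L a × L a * H ≤ m * visits t a + m * L a)
           (occurrences a b va adj) (sym (traversals-cyclic t a b))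
           (cyclic-fair (seq a) (ρ₀ a) b (ρ₀-bound a va (nonempty a va)) (visits t a))

  cut-balance : ∀ c x t → traversals t x (c ∷ x) + 𝟙 (inSubtree (c ∷ x) (P 0))
                         ≡ traversals t (c ∷ x) x + 𝟙 (inSubtree (c ∷ x) (P t))
  cut-balance c x = telescope _ _ (λ s → 𝟙 (inSubtree (c ∷ x) (P s))) (λ s → cut-step c x (adj-step s))

  traversals-balanced : ∀ t {a b} → Adj h a b → traversals t b a ≤ traversals t a b + 1
  traversals-balanced t (inj₁ ((c , refl) , _)) =
    ≤-trans (m≤m+n _ _) (≤-trans (≤-reflexive (sym (cut-balance c _ t))) (+-monoʳ-≤ _ (𝟙≤1 _)))
  traversals-balanced t (inj₂ ((c , refl) , _)) =
    ≤-trans (m≤m+n _ _) (≤-trans (≤-reflexive (cut-balance c _ t)) (+-monoʳ-≤ _ (𝟙≤1 _)))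

  -- Each step departs from one vertex of the tree, so time is the total number of visits.
  visits-invalid : ∀ t z → ¬ Valid h z → visits t z ≡ 0
  visits-invalid t z invalid =
    trans (sumTo-ext t (λ s → ind-no (P s ≟V z) (λ e → invalid (subst (Valid h) e (valid-pos s)))))
          (sumTo-zero t)

  time≤visits : ∀ t → t ≤ sumOver (allVertices h) (visits t)
  time≤visits zero    = z≤n
  time≤visits (suc t) = begin
    suc t                                          ≡⟨ +-comm 1 t ⟩
    t + 1                                          ≤⟨ +-mono-≤ (time≤visits t) departure ⟩
    sumOver (allVertices h) (visits t) + sumOver (allVertices h) (λ z → ind (P t ≟V z))
                                                   ≡⟨ sumOver-+ (allVertices h) _ _ ⟨
    sumOver (allVertices h) (visits (suc t))       ∎
    where
    open ≤-Reasoning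
    departure : 1 ≤ sumOver (allVertices h) (λ z → ind (P t ≟V z))
    departure = subst (_≤ sumOver (allVertices h) (λ z → ind (P t ≟V z))) (ind-yes (P t ≟V P t) refl)
                      (term≤sumOver (λ z → ind (P t ≟V z)) (∈-allVertices h (P t) (valid-pos t)))

  module Bounds (T : ℕ) where

    -- a was left at most B times per incident edge: visits ≤ B·d̃(a)/mult(a) = B·deg(a)
    Bounded : Vertex k → ℕ → Set
    Bounded a B = mult a * visits T a ≤ L a * B

    weaken : ∀ {a B B′} → Bounded a B → B ≤ B′ → Bounded a B′
    weaken {a} bounded B≤B′ = ≤-trans bounded (*-monoʳ-≤ (L a) B≤B′)

    -- a bounded vertex sent ≤ B+K walkers to b, which sent ≤ B+K+1 back, so
    -- by fairness b was left ≤ B + 2K + 1 times per edge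
    propagate : ∀ {a b B} → Valid h a → Adj h a b → Bounded a B → Bounded b (B + slack K)
    propagate {a} {b} {B} va adj bounded = begin
      mult b * visits T b
        ≤⟨ proj₁ (fair T b a vb (Adj-sym adj)) ⟩
      L b * traversals T b a + mult b * L b
        ≤⟨ +-mono-≤ (*-monoʳ-≤ (L b) back) (*-monoˡ-≤ (L b) (mult-≤K b vb)) ⟩
      L b * (B + K + 1) + K * L b
        ≡⟨ collect (L b) B K ⟩
      L b * (B + slack K) ∎
      where
      open ≤-Reasoning
      vb = Adj-valid va adj
      collect : ∀ L B K → L * (B + K + 1) + K * L ≡ L * (B + (K + (1 + K)))
      collect = solve-∀
      absorb : ∀ L B K → L * B + K * L ≡ L * (B + K)
      absorb = solve-∀
      forth : traversals T a b ≤ B + K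
      forth = *-cancelˡ-≤ (L a) {{>-nonZero (nonempty a va)}} (begin
        L a * traversals T a b        ≤⟨ proj₂ (fair T a b va adj) ⟩
        mult a * visits T a + mult a * L a ≤⟨ +-mono-≤ bounded (*-monoˡ-≤ (L a) (mult-≤K a va)) ⟩
        L a * B + K * L a             ≡⟨ absorb (L a) B K ⟩
        L a * (B + K)                 ∎)
      back : traversals T b a ≤ B + K + 1
      back = ≤-trans (traversals-balanced T adj) (+-monoˡ-≤ 1 forth)

    toRoot : ∀ x B → Valid h x → Bounded x B → Bounded [] (B + slack K * length x)
    toRoot []      B _  bounded = weaken bounded (m≤m+n B _)
    toRoot (c ∷ p) B vx bounded =
      weaken (toRoot p (B + slack K) (≤-trans (n≤1+n _) vx) (propagate vx (inj₂ ((c , refl) , vx)) bounded))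
             (≤-reflexive (regroup B (slack K) (length p)))
      where
      regroup : ∀ B S n → B + S + S * n ≡ B + S * suc n
      regroup = solve-∀

    fromRoot : ∀ z B → Valid h z → Bounded [] B → Bounded z (B + slack K * length z)
    fromRoot []      B _  bounded = weaken bounded (m≤m+n B _)
    fromRoot (c ∷ p) B vz bounded =
      weaken (propagate vp (inj₁ ((c , refl) , vz)) (fromRoot p B vp bounded))
             (≤-reflexive (regroup B (slack K) (length p)))
      where
      vp = ≤-trans (n≤1+n _) vz
      regroup : ∀ B S n → B + S * n + S ≡ B + S * suc n
      regroup = solve-∀

    -- every vertex is within 2h edges of u (through the root)
    everywhere : ∀ u → Valid h u → Bounded u K → ∀ z → Valid h z → Bounded z (K + slack K * (h + h))
    everywhere u vu bounded z vz = weaken (fromRoot z _ vz (toRoot u K vu bounded)) (begin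
      K + slack K * length u + slack K * length z   ≡⟨ +-assoc K _ _ ⟩
      K + (slack K * length u + slack K * length z) ≡⟨ cong (K +_) (*-distribˡ-+ (slack K) (length u) (length z)) ⟨
      K + slack K * (length u + length z)           ≤⟨ +-monoʳ-≤ K (*-monoʳ-≤ (slack K) (+-mono-≤ vu vz)) ⟩
      K + slack K * (h + h)                         ∎)
      where open ≤-Reasoning

    -- an untraversed edge u → v makes u bounded: its visits are fair to v
    untraversed-bounded : ∀ u v → Valid h u → Adj h u v → traversals T u v ≡ 0 → Bounded u K
    untraversed-bounded u v vu adj none = begin
      mult u * visits T u               ≤⟨ proj₁ (fair T u v vu adj) ⟩
      L u * traversals T u v + mult u * L u ≡⟨ cong (λ n → L u * n + mult u * L u) none ⟩
      L u * 0 + mult u * L u            ≡⟨ cong (_+ mult u * L u) (*-zeroʳ (L u)) ⟩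
      mult u * L u                      ≤⟨ *-monoˡ-≤ (L u) (mult-≤K u vu) ⟩
      K * L u                           ≡⟨ *-comm K (L u) ⟩
      L u * K                           ∎
      where open ≤-Reasoning

    visits≤ : ∀ z B → Valid h z → Bounded z B → visits T z ≤ suc k * K * B
    visits≤ z B vz bounded = begin
      visits T z          ≤⟨ m≤n*m (visits T z) (mult z) {{>-nonZero (mult-pos z vz)}} ⟩
      mult z * visits T z ≤⟨ bounded ⟩
      L z * B             ≤⟨ *-monoˡ-≤ B (rotor-length≤ rotors z vz) ⟩
      suc k * K * B       ∎
      where open ≤-Reasoning

  untraversed⇒short : ∀ T u v → Valid h u → Adj h u v →
    (∀ s → s < T → ¬ Crosses (P s) (P (suc s)) u v) →
    T ≤ treeSize k h * (suc k * K * (K + slack K * (h + h)))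
  untraversed⇒short T u v vu adj never = begin
    T                                       ≤⟨ time≤visits T ⟩
    sumOver (allVertices h) (visits T)      ≤⟨ sumOver≤ (allVertices h) (visits T) _ visits-bounded ⟩
    length (allVertices h) * (suc k * K * (K + slack K * (h + h)))
                                            ≡⟨ cong (_* (suc k * K * (K + slack K * (h + h)))) (length-allVertices h) ⟩
    treeSize k h * (suc k * K * (K + slack K * (h + h))) ∎
    where
    open ≤-Reasoning
    open Bounds T
    none : traversals T u v ≡ 0
    none = trans (sumTo-ext< T (λ s s<T → ind-no (crosses? (P s) (P (suc s)) u v) (never s s<T))) (sumTo-zero T)
    visits-bounded : ∀ z → visits T z ≤ suc k * K * (K + slack K * (h + h))
    visits-bounded z with length z ≤? h
    ... | yes vz = visits≤ z _ vz (everywhere u vu (untraversed-bounded u v vu adj none) z vz)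
    ... | no  nz = ≤-trans (≤-reflexive (visits-invalid T z nz)) z≤n

  covers-by : ∀ T → treeSize k h * (suc k * K * (K + slack K * (h + h))) < T → CoversEdgesBy h seq ρ₀ u₀ T
  covers-by T large u v vu adj with anyUpTo? (λ t → crosses? (P t) (P (suc t)) u v ⊎-dec crosses? (P t) (P (suc t)) v u) T
  ... | yes traversed = traversed
  ... | no  never     = ⊥-elim (<⇒≱ large (untraversed⇒short T u v vu adj (λ s s<T e → never (s , s<T , inj₁ e))))

2^h≤treeSize : ∀ {k} → 2 ≤ k → ∀ h → 2 ^ h ≤ treeSize k h
2^h≤treeSize k≥2 zero    = s≤s z≤n
2^h≤treeSize k≥2 (suc h) = ≤-trans (*-mono-≤ k≥2 (2^h≤treeSize k≥2 h)) (n≤1+n _)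

depth≤log₂size : ∀ {k} → 2 ≤ k → ∀ h → h ≤ ⌊log₂ treeSize k h ⌋
depth≤log₂size {k} k≥2 h =
  subst (_≤ ⌊log₂ treeSize k h ⌋) (⌊log₂[2^n]⌋≡n h) (⌊log₂⌋-mono-≤ (2^h≤treeSize k≥2 h))

linear-in-depth : ∀ n h lg M S K → 1 ≤ n → 1 ≤ h → h ≤ lg →
  n * (M * (K + S * (h + h))) < suc (M * (K + S * 2)) * n * lg
linear-in-depth n h lg M S K n≥1 h≥1 h≤lg = begin-strict
  n * (M * (K + S * (h + h)))  ≤⟨ *-monoʳ-≤ n (*-monoʳ-≤ M K+2Sh≤) ⟩
  n * (M * ((K + S * 2) * h))  ≡⟨ regroup n M K S h ⟩
  A * (n * h)                  <⟨ m<n+m (A * (n * h)) (*-mono-≤ n≥1 h≥1) ⟩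
  n * h + A * (n * h)          ≡⟨ factor n h A ⟩
  suc A * n * h                ≤⟨ *-monoʳ-≤ (suc A * n) h≤lg ⟩
  suc A * n * lg               ∎
  where
  open ≤-Reasoning
  A = M * (K + S * 2)
  expand : ∀ K S h → (K + S * 2) * h ≡ K * h + S * (h + h)
  expand = solve-∀
  K+2Sh≤ : K + S * (h + h) ≤ (K + S * 2) * h
  K+2Sh≤ = subst (K + S * (h + h) ≤_) (sym (expand K S h))
                 (+-monoˡ-≤ (S * (h + h)) (m≤m*n K h {{>-nonZero h≥1}}))
  regroup : ∀ n M K S h → n * (M * ((K + S * 2) * h)) ≡ M * (K + S * 2) * (n * h)
  regroup = solve-∀
  factor : ∀ n h A → n * h + A * (n * h) ≡ suc A * n * h
  factor = solve-∀

theorem3p17 : (k K : ℕ) → 2 ≤ k → 1 ≤ K →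
    ∃[ C ] ∀ (h : ℕ) (mult : Vertex k → ℕ) (seq : Vertex k → List (Vertex k))
             (ρ₀ : Vertex k → ℕ) (u₀ : Vertex k) →
      ValidRotors k h K mult seq ρ₀ → Valid h u₀ →
      CoversEdgesBy h seq ρ₀ u₀ (C * treeSize k h * ⌊log₂ treeSize k h ⌋)
theorem3p17 k K k≥2 _ = C , covers
  where
  C : ℕ
  C = suc (suc k * K * (K + slack K * 2))

  covers : ∀ h mult seq ρ₀ u₀ → ValidRotors k h K mult seq ρ₀ → Valid h u₀ →
           CoversEdgesBy h seq ρ₀ u₀ (C * treeSize k h * ⌊log₂ treeSize k h ⌋)
  covers zero    _ _ _ _ _ _ u v valid-u adj = ⊥-elim (no-edge-at-depth-0 valid-u adj)
  covers (suc h) _ _ _ u₀ rotors valid-u₀ =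
    Walk.covers-by rotors (rotor-nonempty rotors (≤-trans (s≤s z≤n) k≥2) (s≤s z≤n)) u₀ valid-u₀ _
      (linear-in-depth (treeSize k (suc h)) (suc h) _ (suc k * K) (slack K) K
                       (s≤s z≤n) (s≤s z≤n) (depth≤log₂size k≥2 (suc h)))
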